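{- Let $n>0$ and let $X,Y$ be sets. (1) $Y$ preserves $\Sigma^0_n$-definitions relative to $X$ if and only if $Y$ preserves $\Pi^0_n$-definitions relative to $X$. (2) If $Y$ preserves $\Delta^0_{n+1}$-definitions relative to $X$, then $Y$ preserves $\Pi^0_n$-definitions relative to $X$. (3) $Y$ preserves $\Delta^0_{n+1}$-definitions relative to $X$ if and only if $\Delta^X_{n+1}-\Sigma^X_n\subseteq \Delta^{X\oplus Y}_{n+1}-\Sigma^{X\oplus Y}_n$. (4) Let $\Phi=(\forall X)(\exists Y)\varphi(X,Y)$ with $\varphi$ arithmetic. If for every $Z$, every $X\le_T Z$ and every sequence $(A_i:i<\omega)$ of sets none of which is $\Sigma^Z_n$, there exists $Y$ such that $\varphi(X,Y)$ holds and no $A_i$ is $\Sigma^{Z\oplus Y}_n$, then $\Phi$ admits simultaneous preservation of $\Sigma^0_n$-, $\Pi^0_n$- and $\Delta^0_{n+1}$-definitions.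
   Context: $\Sigma^X_n$, $\Pi^X_n$, $\Delta^X_{n+1}$ denote the classes of sets that are $\Sigma^0_n$, $\Pi^0_n$, $\Delta^0_{n+1}$ relative to $X$. A set is properly $\Sigma^X_n$ if it is $\Sigma^X_n$ but not $\Pi^X_n$; properly $\Pi^X_n$ if $\Pi^X_n$ but not $\Sigma^X_n$; properly $\Delta^X_{n+1}$ if $\Delta^X_{n+1}$ but neither $\Sigma^X_n$ nor $\Pi^X_n$. For $\Xi$ among $\Delta^0_{n+1},\Pi^0_n,\Sigma^0_n$, $Y$ preserves $\Xi$-definitions relative to $X$ if every properly $\Xi$-relative-to-$X$ set is properly $\Xi$ relative to $X\oplus Y$. $\Phi$ admits simultaneous preservation of $\Sigma^0_n$-, $\Pi^0_n$- and $\Delta^0_{n+1}$-definitions if for each $Z$ and $X\le_T Z$ there is $Y$ with $\varphi(X,Y)$ such that $Y$ preserves each of $\Sigma^0_n$-, $\Pi^0_n$- and $\Delta^0_{n+1}$-definitions relative to $Z$. -}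

module Defs where

open import Level using (0ℓ)
open import Data.Nat using (ℕ; zero; suc; _+_; _*_; _<_; _≤_)
open import Data.Fin using (Fin; zero; suc)
open import Data.Bool using (Bool; true; false)
open import Data.Product using (Σ; _×_; _,_; ∃)
open import Data.Sum using (_⊎_)
open import Data.Empty using (⊥)
open import Data.Unit using (⊤)
open import Relation.Nullary using (¬_)
open import Relation.Binary.PropositionalEquality using (_≡_)

SetN : Set
SetN = ℕ → Bool

_∈_ : ℕ → SetN → Set
m ∈ A = A m ≡ true

-- Turing join X ⊕ Y = {2m : m ∈ X} ∪ {2m+1 : m ∈ Y}.
_⊕_ : SetN → SetN → SetN
(X ⊕ Y) zero = X zero
(X ⊕ Y) (suc zero) = Y zero
(X ⊕ Y) (suc (suc m)) = ((λ k → X (suc k)) ⊕ (λ k → Y (suc k))) m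

data Term (v : ℕ) : Set where
  var  : Fin v → Term v
  zer  : Term v
  sc   : Term v → Term v
  _⊞_  : Term v → Term v → Term v
  _⊠_  : Term v → Term v → Term v

data Formula (k v : ℕ) : Set where
  _≐_  : Term v → Term v → Formula k v
  _≺_  : Term v → Term v → Formula k v
  mem  : Fin k → Term v → Formula k v
  ¬'_  : Formula k v → Formula k v
  _∧'_ : Formula k v → Formula k v → Formula k v
  _∨'_ : Formula k v → Formula k v → Formula k v
  _⇒'_ : Formula k v → Formula k v → Formula k v
  ∀<   : Term v → Formula k (suc v) → Formula k v
  ∃<   : Term v → Formula k (suc v) → Formula k v
  ∀'   : Formula k (suc v) → Formula k v
  ∃'   : Formula k (suc v) → Formula k v

extend : ∀ {v} → ℕ → (Fin v → ℕ) → Fin (suc v) → ℕ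
extend m ρ zero = m
extend m ρ (suc i) = ρ i

evalT : ∀ {v} → (Fin v → ℕ) → Term v → ℕ
evalT ρ (var i) = ρ i
evalT ρ zer = zero
evalT ρ (sc t) = suc (evalT ρ t)
evalT ρ (s ⊞ t) = evalT ρ s + evalT ρ t
evalT ρ (s ⊠ t) = evalT ρ s * evalT ρ t

Sat : ∀ {k v} → (Fin k → SetN) → (Fin v → ℕ) → Formula k v → Set
Sat 𝒳 ρ (s ≐ t) = evalT ρ s ≡ evalT ρ t
Sat 𝒳 ρ (s ≺ t) = evalT ρ s < evalT ρ t
Sat 𝒳 ρ (mem i t) = evalT ρ t ∈ 𝒳 i
Sat 𝒳 ρ (¬' φ) = ¬ Sat 𝒳 ρ φ
Sat 𝒳 ρ (φ ∧' ψ) = Sat 𝒳 ρ φ × Sat 𝒳 ρ ψ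
Sat 𝒳 ρ (φ ∨' ψ) = Sat 𝒳 ρ φ ⊎ Sat 𝒳 ρ ψ
Sat 𝒳 ρ (φ ⇒' ψ) = Sat 𝒳 ρ φ → Sat 𝒳 ρ ψ
Sat 𝒳 ρ (∀< t φ) = ∀ m → m < evalT ρ t → Sat 𝒳 (extend m ρ) φ
Sat 𝒳 ρ (∃< t φ) = Σ ℕ λ m → m < evalT ρ t × Sat 𝒳 (extend m ρ) φ
Sat 𝒳 ρ (∀' φ) = ∀ m → Sat 𝒳 (extend m ρ) φ
Sat 𝒳 ρ (∃' φ) = Σ ℕ λ m → Sat 𝒳 (extend m ρ) φ

IsΔ₀ : ∀ {k v} → Formula k v → Set
IsΔ₀ (s ≐ t) = ⊤
IsΔ₀ (s ≺ t) = ⊤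
IsΔ₀ (mem i t) = ⊤
IsΔ₀ (¬' φ) = IsΔ₀ φ
IsΔ₀ (φ ∧' ψ) = IsΔ₀ φ × IsΔ₀ ψ
IsΔ₀ (φ ∨' ψ) = IsΔ₀ φ × IsΔ₀ ψ
IsΔ₀ (φ ⇒' ψ) = IsΔ₀ φ × IsΔ₀ ψ
IsΔ₀ (∀< t φ) = IsΔ₀ φ
IsΔ₀ (∃< t φ) = IsΔ₀ φ
IsΔ₀ (∀' φ) = ⊥
IsΔ₀ (∃' φ) = ⊥

mutual
  data IsΣ {k : ℕ} : ℕ → ∀ {v} → Formula k v → Set where
    σ₀   : ∀ {v} {φ : Formula k v} → IsΔ₀ φ → IsΣ zero φ
    σ∃   : ∀ {n v} {φ : Formula k (suc v)} → IsΣ (suc n) φ → IsΣ (suc n) (∃' φ)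
    σΠ   : ∀ {n v} {φ : Formula k (suc v)} → IsΠ n φ → IsΣ (suc n) (∃' φ)

  data IsΠ {k : ℕ} : ℕ → ∀ {v} → Formula k v → Set where
    π₀   : ∀ {v} {φ : Formula k v} → IsΔ₀ φ → IsΠ zero φ
    π∀   : ∀ {n v} {φ : Formula k (suc v)} → IsΠ (suc n) φ → IsΠ (suc n) (∀' φ)
    πΣ   : ∀ {n v} {φ : Formula k (suc v)} → IsΣ n φ → IsΠ (suc n) (∀' φ)

one : SetN → Fin 1 → SetN
one X zero = X

two : SetN → SetN → Fin 2 → SetN
two X Y zero = X
two X Y (suc zero) = Y

DefinedBy : SetN → Formula 1 1 → SetN → Set
DefinedBy X φ A = ∀ m → (m ∈ A → Sat (one X) (extend m (λ ())) φ)
                      × (Sat (one X) (extend m (λ ())) φ → m ∈ A)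

Σ⁰ : ℕ → SetN → SetN → Set
Σ⁰ n X A = Σ (Formula 1 1) λ φ → IsΣ n φ × DefinedBy X φ A

Π⁰ : ℕ → SetN → SetN → Set
Π⁰ n X A = Σ (Formula 1 1) λ φ → IsΠ n φ × DefinedBy X φ A

-- Δ⁰ n X A : A is Δ^X_n  (so Δ^X_{n+1} is Δ⁰ (suc n) X)
Δ⁰ : ℕ → SetN → SetN → Set
Δ⁰ n X A = Σ⁰ n X A × Π⁰ n X A

ProperΣ : ℕ → SetN → SetN → Set
ProperΣ n X A = Σ⁰ n X A × ¬ Π⁰ n X A

ProperΠ : ℕ → SetN → SetN → Set
ProperΠ n X A = Π⁰ n X A × ¬ Σ⁰ n X A

ProperΔ : ℕ → SetN → SetN → Set
ProperΔ n X A = Δ⁰ (suc n) X A × ¬ Σ⁰ n X A × ¬ Π⁰ n X A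

PresΣ : ℕ → SetN → SetN → Set
PresΣ n X Y = ∀ A → ProperΣ n X A → ProperΣ n (X ⊕ Y) A

PresΠ : ℕ → SetN → SetN → Set
PresΠ n X Y = ∀ A → ProperΠ n X A → ProperΠ n (X ⊕ Y) A

PresΔ : ℕ → SetN → SetN → Set
PresΔ n X Y = ∀ A → ProperΔ n X A → ProperΔ n (X ⊕ Y) A

-- Turing reducibility X ≤_T Z, via Post/Kleene: X is Δ⁰₁ relative to Z.
_≤T_ : SetN → SetN → Set
X ≤T Z = Δ⁰ 1 Z X

-- Φ = ∀X ∃Y φ(X,Y), φ arithmetic with set parameters X (index 0), Y (index 1).
Holds : Formula 2 0 → SetN → SetN → Set
Holds φ X Y = Sat (two X Y) (λ ()) φ

AdmitsSimulPres : ℕ → Formula 2 0 → Set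
AdmitsSimulPres n φ = ∀ Z X → X ≤T Z → Σ SetN λ Y →
  Holds φ X Y × PresΣ n Z Y × PresΠ n Z Y × PresΔ n Z Y

module Submission where

-- Parts (1)-(3) follow by complementation and by the properly-Δₙ₊₁ set
-- A ⊕ ∁A built from a properly Πₙ set A.  For part (4), formulas are coded
-- injectively by numbers; this yields one sequence listing every set
-- arithmetical in Z that is not Σᶻₙ (padded with a diagonal set, which is
-- not even definable), and a Y avoiding all of them preserves everything.

open import Defs
open import Level using (0ℓ)
open import Axiom.ExcludedMiddle using (ExcludedMiddle)
open import Data.Nat using (ℕ; zero; suc; _+_; _*_; _<_)
open import Data.Nat.Properties using (+-suc; suc-injective; *-cancelˡ-≡; even≢odd)
open import Data.Fin using (Fin; zero; suc; toℕ)
open import Data.List using (List; []; _∷_)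
open import Data.Maybe using (Maybe; just; nothing; maybe′)
import Data.Maybe as Maybe
open import Data.Bool using (true; false; not)
open import Data.Bool.Properties using (not-involutive)
open import Data.Product using (Σ; _×_; _,_; proj₁; proj₂)
open import Data.Product.Function.NonDependent.Propositional using (_×-⇔_)
open import Data.Sum using (_⊎_; inj₁; inj₂; swap; [_,_]′)
open import Data.Sum.Function.Propositional using (_⊎-⇔_)
open import Data.Empty using (⊥-elim)
open import Function.Base using (_∘_; id)
open import Function.Bundles using (_⇔_; mk⇔; Equivalence)
open import Function.Construct.Identity using (⇔-id)
open import Function.Construct.Symmetry using (⇔-sym)
open import Function.Construct.Composition using (_⇔-∘_)
open import Function.Related.TypeIsomorphisms using (→-cong-⇔; ¬-cong-⇔)
open import Relation.Nullary using (¬_; Dec; yes; no; does)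
open import Relation.Binary.PropositionalEquality
  using (_≡_; refl; sym; trans; cong; cong₂; subst; module ≡-Reasoning)
open Equivalence using (to; from)

variable
  k v w n : ℕ

∀-⇔ : {P Q : ℕ → Set} → (∀ m → P m ⇔ Q m) → (∀ m → P m) ⇔ (∀ m → Q m)
∀-⇔ h = mk⇔ (λ f m → to (h m) (f m)) (λ f m → from (h m) (f m))

∃-⇔ : {P Q : ℕ → Set} → (∀ m → P m ⇔ Q m) → Σ ℕ P ⇔ Σ ℕ Q
∃-⇔ h = mk⇔ (λ (m , p) → m , to (h m) p) (λ (m , q) → m , from (h m) q)

≡⇒⇔ : {S T : Set} → S ≡ T → S ⇔ T
≡⇒⇔ refl = ⇔-id _

¬[S⇔¬S] : {S : Set} → ¬ (S ⇔ (¬ S))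
¬[S⇔¬S] {S} e = ¬s (from e ¬s)
  where
    ¬s : ¬ S
    ¬s s = to e s s

module _ (em : ExcludedMiddle 0ℓ) where

  dne : {S : Set} → ¬ ¬ S → S
  dne {S} ¬¬s with em {S}
  ... | yes s = s
  ... | no ¬s = ⊥-elim (¬¬s ¬s)

  ∀-⊎-const : {P : ℕ → Set} {Q : Set} → (∀ m → P m ⊎ Q) ⇔ ((∀ m → P m) ⊎ Q)
  ∀-⊎-const {P} {Q} = mk⇔ split (λ { (inj₁ f) m → inj₁ (f m) ; (inj₂ q) m → inj₂ q })
    where
      split : (∀ m → P m ⊎ Q) → (∀ m → P m) ⊎ Q
      split f with em {Q}
      ... | yes q = inj₂ q
      ... | no ¬q = inj₁ λ m → [ id , ⊥-elim ∘ ¬q ]′ (f m)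

  ∃¬⇔¬∀ : {P : ℕ → Set} → Σ ℕ (λ m → ¬ P m) ⇔ (¬ (∀ m → P m))
  ∃¬⇔¬∀ = mk⇔ (λ (m , ¬p) f → ¬p (f m))
               (λ ¬∀ → dne λ ¬∃ → ¬∀ λ m → dne λ ¬p → ¬∃ (m , ¬p))

Sub : ℕ → ℕ → Set
Sub v w = Fin v → Term w

substT : Sub v w → Term v → Term w
substT σ (var i) = σ i
substT σ zer = zer
substT σ (sc t) = sc (substT σ t)
substT σ (s ⊞ t) = substT σ s ⊞ substT σ t
substT σ (s ⊠ t) = substT σ s ⊠ substT σ t

shift : Sub v (suc v)
shift i = var (suc i)

liftS : Sub v w → Sub (suc v) (suc w)
liftS σ zero = var zero
liftS σ (suc i) = substT shift (σ i)

substF : Sub v w → Formula k v → Formula k w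
substF σ (s ≐ t) = substT σ s ≐ substT σ t
substF σ (s ≺ t) = substT σ s ≺ substT σ t
substF σ (mem i t) = mem i (substT σ t)
substF σ (¬' φ) = ¬' substF σ φ
substF σ (φ ∧' ψ) = substF σ φ ∧' substF σ ψ
substF σ (φ ∨' ψ) = substF σ φ ∨' substF σ ψ
substF σ (φ ⇒' ψ) = substF σ φ ⇒' substF σ ψ
substF σ (∀< t φ) = ∀< (substT σ t) (substF (liftS σ) φ)
substF σ (∃< t φ) = ∃< (substT σ t) (substF (liftS σ) φ)
substF σ (∀' φ) = ∀' (substF (liftS σ) φ)
substF σ (∃' φ) = ∃' (substF (liftS σ) φ)

wk : Formula k v → Formula k (suc v)
wk = substF shift

Realises : Sub v w → (Fin w → ℕ) → (Fin v → ℕ) → Set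
Realises σ ρ ρ′ = ∀ i → evalT ρ (σ i) ≡ ρ′ i

evalT-subst : {σ : Sub v w} {ρ : Fin w → ℕ} {ρ′ : Fin v → ℕ} →
  Realises σ ρ ρ′ → ∀ t → evalT ρ (substT σ t) ≡ evalT ρ′ t
evalT-subst h (var i) = h i
evalT-subst h zer = refl
evalT-subst h (sc t) = cong suc (evalT-subst h t)
evalT-subst h (s ⊞ t) = cong₂ _+_ (evalT-subst h s) (evalT-subst h t)
evalT-subst h (s ⊠ t) = cong₂ _*_ (evalT-subst h s) (evalT-subst h t)

realises-lift : {σ : Sub v w} {ρ : Fin w → ℕ} {ρ′ : Fin v → ℕ} →
  Realises σ ρ ρ′ → ∀ m → Realises (liftS σ) (extend m ρ) (extend m ρ′)
realises-lift h m zero = refl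
realises-lift {σ = σ} h m (suc i) = trans (evalT-subst (λ _ → refl) (σ i)) (h i)

module _ (𝒳 : Fin k → SetN) where

  Sat-subst : {σ : Sub v w} {ρ : Fin w → ℕ} {ρ′ : Fin v → ℕ} →
    Realises σ ρ ρ′ → ∀ φ → Sat 𝒳 ρ (substF σ φ) ⇔ Sat 𝒳 ρ′ φ
  Sat-subst h (s ≐ t) = ≡⇒⇔ (cong₂ _≡_ (evalT-subst h s) (evalT-subst h t))
  Sat-subst h (s ≺ t) = ≡⇒⇔ (cong₂ _<_ (evalT-subst h s) (evalT-subst h t))
  Sat-subst h (mem i t) = ≡⇒⇔ (cong (λ m → m ∈ 𝒳 i) (evalT-subst h t))
  Sat-subst h (¬' φ) = ¬-cong-⇔ (Sat-subst h φ)
  Sat-subst h (φ ∧' ψ) = Sat-subst h φ ×-⇔ Sat-subst h ψ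
  Sat-subst h (φ ∨' ψ) = Sat-subst h φ ⊎-⇔ Sat-subst h ψ
  Sat-subst h (φ ⇒' ψ) = →-cong-⇔ (Sat-subst h φ) (Sat-subst h ψ)
  Sat-subst h (∀< t φ) = ∀-⇔ λ m →
    →-cong-⇔ (≡⇒⇔ (cong (m <_) (evalT-subst h t))) (Sat-subst (realises-lift h m) φ)
  Sat-subst h (∃< t φ) = ∃-⇔ λ m →
    ≡⇒⇔ (cong (m <_) (evalT-subst h t)) ×-⇔ Sat-subst (realises-lift h m) φ
  Sat-subst h (∀' φ) = ∀-⇔ λ m → Sat-subst (realises-lift h m) φ
  Sat-subst h (∃' φ) = ∃-⇔ λ m → Sat-subst (realises-lift h m) φ

  Sat-env : {ρ ρ′ : Fin v → ℕ} → (∀ i → ρ i ≡ ρ′ i) → ∀ φ → Sat 𝒳 ρ φ ⇔ Sat 𝒳 ρ′ φ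
  Sat-env h φ = Sat-subst {σ = var} h φ ⇔-∘ ⇔-sym (Sat-subst {σ = var} (λ _ → refl) φ)

  Sat-wk : {ρ : Fin v → ℕ} (m : ℕ) (φ : Formula k v) → Sat 𝒳 (extend m ρ) (wk φ) ⇔ Sat 𝒳 ρ φ
  Sat-wk m φ = Sat-subst (λ _ → refl) φ

Δ₀-subst : (σ : Sub v w) (φ : Formula k v) → IsΔ₀ φ → IsΔ₀ (substF σ φ)
Δ₀-subst σ (s ≐ t) d = d
Δ₀-subst σ (s ≺ t) d = d
Δ₀-subst σ (mem i t) d = d
Δ₀-subst σ (¬' φ) d = Δ₀-subst σ φ d
Δ₀-subst σ (φ ∧' ψ) (a , b) = Δ₀-subst σ φ a , Δ₀-subst σ ψ b
Δ₀-subst σ (φ ∨' ψ) (a , b) = Δ₀-subst σ φ a , Δ₀-subst σ ψ b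
Δ₀-subst σ (φ ⇒' ψ) (a , b) = Δ₀-subst σ φ a , Δ₀-subst σ ψ b
Δ₀-subst σ (∀< t φ) d = Δ₀-subst (liftS σ) φ d
Δ₀-subst σ (∃< t φ) d = Δ₀-subst (liftS σ) φ d

mutual
  Σ-subst : (σ : Sub v w) {φ : Formula k v} → IsΣ n φ → IsΣ n (substF σ φ)
  Σ-subst σ (σ₀ {φ = φ} d) = σ₀ (Δ₀-subst σ φ d)
  Σ-subst σ (σ∃ p) = σ∃ (Σ-subst (liftS σ) p)
  Σ-subst σ (σΠ p) = σΠ (Π-subst (liftS σ) p)

  Π-subst : (σ : Sub v w) {φ : Formula k v} → IsΠ n φ → IsΠ n (substF σ φ)
  Π-subst σ (π₀ {φ = φ} d) = π₀ (Δ₀-subst σ φ d)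
  Π-subst σ (π∀ p) = π∀ (Π-subst (liftS σ) p)
  Π-subst σ (πΣ p) = πΣ (Σ-subst (liftS σ) p)

Pred : ℕ → Set₁
Pred v = (Fin v → ℕ) → Set

_≃_ : Pred v → Pred v → Set
P ≃ Q = ∀ ρ → P ρ ⇔ Q ρ

_∩_ : Pred v → Pred v → Pred v
(P ∩ Q) ρ = P ρ × Q ρ

_∪_ : Pred v → Pred v → Pred v
(P ∪ Q) ρ = P ρ ⊎ Q ρ

∁ᴾ : Pred v → Pred v
∁ᴾ P ρ = ¬ P ρ

∃ᴾ : Pred (suc v) → Pred v
∃ᴾ P ρ = Σ ℕ λ m → P (extend m ρ)

∀ᴾ : Pred (suc v) → Pred v
∀ᴾ P ρ = ∀ m → P (extend m ρ)

≃-trans : {P Q R : Pred v} → P ≃ Q → Q ≃ R → P ≃ R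
≃-trans e f ρ = f ρ ⇔-∘ e ρ

∪-comm : {P Q : Pred v} → (P ∪ Q) ≃ (Q ∪ P)
∪-comm ρ = mk⇔ swap swap

∃ᴾ-∪ : {P Q : Pred (suc v)} → ∃ᴾ (P ∪ Q) ≃ (∃ᴾ P ∪ ∃ᴾ Q)
∃ᴾ-∪ ρ = mk⇔ (λ { (m , inj₁ p) → inj₁ (m , p) ; (m , inj₂ q) → inj₂ (m , q) })
              (λ { (inj₁ (m , p)) → m , inj₁ p ; (inj₂ (m , q)) → m , inj₂ q })

∀ᴾ-¬ : {P : Pred (suc v)} → ∀ᴾ (∁ᴾ P) ≃ ∁ᴾ (∃ᴾ P)
∀ᴾ-¬ ρ = mk⇔ (λ f (m , p) → f m p) (λ g m p → g (m , p))

module Forms (𝒳 : Fin k → SetN) where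

  ⟦_⟧ : Formula k v → Pred v
  ⟦ φ ⟧ ρ = Sat 𝒳 ρ φ

  record ΣForm (n : ℕ) (P : Pred v) : Set where
    constructor Σform
    field
      formula : Formula k v
      isΣ     : IsΣ n formula
      meaning : ⟦ formula ⟧ ≃ P

  record ΠForm (n : ℕ) (P : Pred v) : Set where
    constructor Πform
    field
      formula : Formula k v
      isΠ     : IsΠ n formula
      meaning : ⟦ formula ⟧ ≃ P

  asΣ : {φ : Formula k v} → IsΣ n φ → ΣForm n ⟦ φ ⟧
  asΣ p = Σform _ p λ _ → ⇔-id _

  asΠ : {φ : Formula k v} → IsΠ n φ → ΠForm n ⟦ φ ⟧
  asΠ p = Πform _ p λ _ → ⇔-id _

  ΣForm-resp : {P Q : Pred v} → P ≃ Q → ΣForm n P → ΣForm n Q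
  ΣForm-resp e (Σform χ p f) = Σform χ p (≃-trans f e)

  ΠForm-resp : {P Q : Pred v} → P ≃ Q → ΠForm n P → ΠForm n Q
  ΠForm-resp e (Πform χ p f) = Πform χ p (≃-trans f e)

  ∃Σ : {P : Pred (suc v)} → ΣForm (suc n) P → ΣForm (suc n) (∃ᴾ P)
  ∃Σ (Σform χ p e) = Σform (∃' χ) (σ∃ p) λ ρ → ∃-⇔ λ m → e (extend m ρ)

  ∃Π : {P : Pred (suc v)} → ΠForm n P → ΣForm (suc n) (∃ᴾ P)
  ∃Π (Πform χ p e) = Σform (∃' χ) (σΠ p) λ ρ → ∃-⇔ λ m → e (extend m ρ)

  ∀Π : {P : Pred (suc v)} → ΠForm (suc n) P → ΠForm (suc n) (∀ᴾ P)
  ∀Π (Πform χ p e) = Πform (∀' χ) (π∀ p) λ ρ → ∀-⇔ λ m → e (extend m ρ)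

  ∀Σ : {P : Pred (suc v)} → ΣForm n P → ΠForm (suc n) (∀ᴾ P)
  ∀Σ (Σform χ p e) = Πform (∀' χ) (πΣ p) λ ρ → ∀-⇔ λ m → e (extend m ρ)

  substΣ : {P : Pred v} (σ : Sub v w) → ΣForm n P → ΣForm n (λ ρ → P (λ i → evalT ρ (σ i)))
  substΣ σ (Σform χ p e) = Σform (substF σ χ) (Σ-subst σ p) λ ρ → e _ ⇔-∘ Sat-subst 𝒳 (λ _ → refl) χ

  substΠ : {P : Pred v} (σ : Sub v w) → ΠForm n P → ΠForm n (λ ρ → P (λ i → evalT ρ (σ i)))
  substΠ σ (Πform χ p e) = Πform (substF σ χ) (Π-subst σ p) λ ρ → e _ ⇔-∘ Sat-subst 𝒳 (λ _ → refl) χ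

  -- Prenex laws: a quantifier over a variable not free in a weakened
  -- formula can be dropped or moved past ∧ and ∨ (ℕ is inhabited).
  ∃ᴾ-wk : (φ : Formula k v) → ∃ᴾ ⟦ wk φ ⟧ ≃ ⟦ φ ⟧
  ∃ᴾ-wk φ ρ = mk⇔ (λ (m , s) → to (Sat-wk 𝒳 m φ) s) (λ s → 0 , from (Sat-wk 𝒳 0 φ) s)

  ∀ᴾ-wk : (φ : Formula k v) → ∀ᴾ ⟦ wk φ ⟧ ≃ ⟦ φ ⟧
  ∀ᴾ-wk φ ρ = mk⇔ (λ f → to (Sat-wk 𝒳 0 φ) (f 0)) (λ s m → from (Sat-wk 𝒳 m φ) s)

  ∃ᴾ-wk-∩ : (θ : Formula k v) {P : Pred (suc v)} → ∃ᴾ (⟦ wk θ ⟧ ∩ P) ≃ (⟦ θ ⟧ ∩ ∃ᴾ P)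
  ∃ᴾ-wk-∩ θ ρ = mk⇔ (λ (m , t , p) → to (Sat-wk 𝒳 m θ) t , m , p)
                     (λ (t , m , p) → m , from (Sat-wk 𝒳 m θ) t , p)

  ∀ᴾ-wk-∩ : (θ : Formula k v) {P : Pred (suc v)} → ∀ᴾ (⟦ wk θ ⟧ ∩ P) ≃ (⟦ θ ⟧ ∩ ∀ᴾ P)
  ∀ᴾ-wk-∩ θ ρ = mk⇔ (λ f → to (Sat-wk 𝒳 0 θ) (proj₁ (f 0)) , λ m → proj₂ (f m))
                     (λ (t , g) m → from (Sat-wk 𝒳 m θ) t , g m)

  ∃ᴾ-∪-wk : {P : Pred (suc v)} (ψ : Formula k v) → ∃ᴾ (P ∪ ⟦ wk ψ ⟧) ≃ (∃ᴾ P ∪ ⟦ ψ ⟧)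
  ∃ᴾ-∪-wk ψ ρ = mk⇔ (λ { (m , inj₁ p) → inj₁ (m , p) ; (m , inj₂ s) → inj₂ (to (Sat-wk 𝒳 m ψ) s) })
                     (λ { (inj₁ (m , p)) → m , inj₁ p ; (inj₂ s) → 0 , inj₂ (from (Sat-wk 𝒳 0 ψ) s) })

  -- Inclusions Πₙ ⊆ Σₙ₊₁ and Σₙ ⊆ Πₙ₊₁, by a dummy quantifier.
  Π⊆Σ↑ : {φ : Formula k v} → IsΠ n φ → ΣForm (suc n) ⟦ φ ⟧
  Π⊆Σ↑ {φ = φ} p = ΣForm-resp (∃ᴾ-wk φ) (∃Π (asΠ (Π-subst shift p)))

  Σ⊆Π↑ : {φ : Formula k v} → IsΣ n φ → ΠForm (suc n) ⟦ φ ⟧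
  Σ⊆Π↑ {φ = φ} p = ΠForm-resp (∀ᴾ-wk φ) (∀Σ (asΣ (Σ-subst shift p)))

  mutual
    Σ↑ : {φ : Formula k v} → IsΣ n φ → ΣForm (suc n) ⟦ φ ⟧
    Σ↑ (σ₀ d) = Π⊆Σ↑ (π₀ d)
    Σ↑ (σ∃ {φ = φ} p) = ∃Σ {P = ⟦ φ ⟧} (Σ↑ p)
    Σ↑ (σΠ {φ = φ} p) = ∃Π {P = ⟦ φ ⟧} (Π↑ p)

    Π↑ : {φ : Formula k v} → IsΠ n φ → ΠForm (suc n) ⟦ φ ⟧
    Π↑ (π₀ d) = Σ⊆Π↑ (σ₀ d)
    Π↑ (π∀ {φ = φ} p) = ∀Π {P = ⟦ φ ⟧} (Π↑ p)
    Π↑ (πΣ {φ = φ} p) = ∀Σ {P = ⟦ φ ⟧} (Σ↑ p)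

  -- Conjunction with a bounded formula θ: push θ into the matrix.
  mutual
    ∧Σ : {θ φ : Formula k v} → IsΔ₀ θ → IsΣ n φ → ΣForm n (⟦ θ ⟧ ∩ ⟦ φ ⟧)
    ∧Σ {θ = θ} {φ} d (σ₀ e) = asΣ {φ = θ ∧' φ} (σ₀ (d , e))
    ∧Σ {θ = θ} d (σ∃ {φ = φ} p) = ΣForm-resp (∃ᴾ-wk-∩ θ {⟦ φ ⟧}) (∃Σ (∧Σ (Δ₀-subst shift θ d) p))
    ∧Σ {θ = θ} d (σΠ {φ = φ} p) = ΣForm-resp (∃ᴾ-wk-∩ θ {⟦ φ ⟧}) (∃Π (∧Π (Δ₀-subst shift θ d) p))

    ∧Π : {θ φ : Formula k v} → IsΔ₀ θ → IsΠ n φ → ΠForm n (⟦ θ ⟧ ∩ ⟦ φ ⟧)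
    ∧Π {θ = θ} {φ} d (π₀ e) = asΠ {φ = θ ∧' φ} (π₀ (d , e))
    ∧Π {θ = θ} d (π∀ {φ = φ} p) = ΠForm-resp (∀ᴾ-wk-∩ θ {⟦ φ ⟧}) (∀Π (∧Π (Δ₀-subst shift θ d) p))
    ∧Π {θ = θ} d (πΣ {φ = φ} p) = ΠForm-resp (∀ᴾ-wk-∩ θ {⟦ φ ⟧}) (∀Σ (∧Σ (Δ₀-subst shift θ d) p))

  ∩Σ : {θ : Formula k v} {P : Pred v} → IsΔ₀ θ → ΣForm n P → ΣForm n (⟦ θ ⟧ ∩ P)
  ∩Σ d (Σform χ p e) = ΣForm-resp (λ ρ → ⇔-id _ ×-⇔ e ρ) (∧Σ d p)

module ClassicalForms (em : ExcludedMiddle 0ℓ) (𝒳 : Fin k → SetN) where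
  open Forms 𝒳

  ∀ᴾ-∪-wk : {P : Pred (suc v)} (ψ : Formula k v) → ∀ᴾ (P ∪ ⟦ wk ψ ⟧) ≃ (∀ᴾ P ∪ ⟦ ψ ⟧)
  ∀ᴾ-∪-wk ψ ρ = ∀-⊎-const em ⇔-∘ ∀-⇔ λ m → ⇔-id _ ⊎-⇔ Sat-wk 𝒳 m ψ

  ∃ᴾ-¬ : {P : Pred (suc v)} → ∃ᴾ (∁ᴾ P) ≃ ∁ᴾ (∀ᴾ P)
  ∃ᴾ-¬ ρ = ∃¬⇔¬∀ em

  mutual
    ¬Σ : {φ : Formula k v} → IsΣ n φ → ΠForm n (∁ᴾ ⟦ φ ⟧)
    ¬Σ {φ = φ} (σ₀ d) = asΠ {φ = ¬' φ} (π₀ d)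
    ¬Σ (σ∃ {φ = φ} p) = ΠForm-resp (∀ᴾ-¬ {P = ⟦ φ ⟧}) (∀Π (¬Σ p))
    ¬Σ (σΠ {φ = φ} p) = ΠForm-resp (∀ᴾ-¬ {P = ⟦ φ ⟧}) (∀Σ (¬Π p))

    ¬Π : {φ : Formula k v} → IsΠ n φ → ΣForm n (∁ᴾ ⟦ φ ⟧)
    ¬Π {φ = φ} (π₀ d) = asΣ {φ = ¬' φ} (σ₀ d)
    ¬Π (π∀ {φ = φ} p) = ΣForm-resp (∃ᴾ-¬ {P = ⟦ φ ⟧}) (∃Σ (¬Π p))
    ¬Π (πΣ {φ = φ} p) = ΣForm-resp (∃ᴾ-¬ {P = ⟦ φ ⟧}) (∃Π (¬Σ p))

  -- Disjunction: pull the quantifiers of the left disjunct out, then those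
  -- of the right one (∨ΠΣ, ∨ΣΠ), until both matrices are one level lower;
  -- two ∃-blocks may share their variable.  The recursion descends in n.
  mutual
    ∨Σ : {φ ψ : Formula k v} → IsΣ n φ → IsΣ n ψ → ΣForm n (⟦ φ ⟧ ∪ ⟦ ψ ⟧)
    ∨Σ {φ = φ} {ψ} (σ₀ a) (σ₀ b) = asΣ {φ = φ ∨' ψ} (σ₀ (a , b))
    ∨Σ {ψ = ψ} (σ∃ {φ = φ} p) q = ΣForm-resp (∃ᴾ-∪-wk {P = ⟦ φ ⟧} ψ) (∃Σ (∨Σ p (Σ-subst shift q)))
    ∨Σ {n = suc n} (σΠ p) q = ΣForm-resp ∪-comm (∨ΠΣ p q)

    ∨ΠΣ : {φ : Formula k (suc v)} {ψ : Formula k v} → IsΠ n φ → IsΣ (suc n) ψ →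
      ΣForm (suc n) (⟦ ψ ⟧ ∪ ⟦ ∃' φ ⟧)
    ∨ΠΣ {φ = φ} p (σ∃ {φ = ψ} q) =
      ΣForm-resp (∃ᴾ-∪-wk {P = ⟦ ψ ⟧} (∃' φ)) (∃Σ (∨ΠΣ (Π-subst (liftS shift) p) q))
    ∨ΠΣ {φ = φ} p (σΠ {φ = ψ} q) = ΣForm-resp (∃ᴾ-∪ {P = ⟦ ψ ⟧} {⟦ φ ⟧}) (∃Π (∨Π q p))

    ∨Π : {φ ψ : Formula k v} → IsΠ n φ → IsΠ n ψ → ΠForm n (⟦ φ ⟧ ∪ ⟦ ψ ⟧)
    ∨Π {φ = φ} {ψ} (π₀ a) (π₀ b) = asΠ {φ = φ ∨' ψ} (π₀ (a , b))
    ∨Π {ψ = ψ} (π∀ {φ = φ} p) q = ΠForm-resp (∀ᴾ-∪-wk {P = ⟦ φ ⟧} ψ) (∀Π (∨Π p (Π-subst shift q)))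
    ∨Π {n = suc n} (πΣ p) q = ΠForm-resp ∪-comm (∨ΣΠ p q)

    ∨ΣΠ : {φ : Formula k (suc v)} {ψ : Formula k v} → IsΣ n φ → IsΠ (suc n) ψ →
      ΠForm (suc n) (⟦ ψ ⟧ ∪ ⟦ ∀' φ ⟧)
    ∨ΣΠ {φ = φ} p (π∀ {φ = ψ} q) =
      ΠForm-resp (∀ᴾ-∪-wk {P = ⟦ ψ ⟧} (∀' φ)) (∀Π (∨ΣΠ (Σ-subst (liftS shift) p) q))
    ∨ΣΠ {φ = φ} p (πΣ {φ = ψ} q) =
      ΠForm-resp (∀ᴾ-∪-wk {P = ⟦ ψ ⟧} (∀' φ))
        (∀Π (ΠForm-resp (≃-trans (∀ᴾ-∪-wk {P = ⟦ substF (liftS shift) φ ⟧} ψ) ∪-comm)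
          (∀Σ (∨Σ (Σ-subst (liftS shift) p) (Σ-subst shift q)))))

  ∪Σ : {P Q : Pred v} → ΣForm n P → ΣForm n Q → ΣForm n (P ∪ Q)
  ∪Σ (Σform χ p e) (Σform χ′ q e′) = ΣForm-resp (λ ρ → e ρ ⊎-⇔ e′ ρ) (∨Σ p q)

At : SetN → Pred 1
At A ρ = ρ zero ∈ A

_≈_ : SetN → SetN → Set
A ≈ B = ∀ m → m ∈ A ⇔ m ∈ B

≗⇒≈ : {A B : SetN} → (∀ m → A m ≡ B m) → A ≈ B
≗⇒≈ e m = ≡⇒⇔ (cong (_≡ true) (e m))

≈-sym : {A B : SetN} → A ≈ B → B ≈ A
≈-sym e m = ⇔-sym (e m)

module _ {X : SetN} where
  open Forms (one X)

  defines : {φ : Formula 1 1} {A : SetN} → DefinedBy X φ A → ⟦ φ ⟧ ≃ At A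
  defines {φ} d ρ = mk⇔ (proj₂ (d (ρ zero)) ∘ to same-point) (from same-point ∘ proj₁ (d (ρ zero)))
    where
      same-point : Sat (one X) ρ φ ⇔ Sat (one X) (extend (ρ zero) (λ ())) φ
      same-point = Sat-env (one X) (λ { zero → refl ; (suc ()) }) φ

  Σ⁰-form : {A : SetN} → Σ⁰ n X A → ΣForm n (At A)
  Σ⁰-form (φ , p , d) = Σform φ p (defines d)

  Π⁰-form : {A : SetN} → Π⁰ n X A → ΠForm n (At A)
  Π⁰-form (φ , p , d) = Πform φ p (defines d)

  form-Σ⁰ : {A : SetN} → ΣForm n (At A) → Σ⁰ n X A
  form-Σ⁰ (Σform φ p e) = φ , p , λ m → from (e _) , to (e _)

  form-Π⁰ : {A : SetN} → ΠForm n (At A) → Π⁰ n X A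
  form-Π⁰ (Πform φ p e) = φ , p , λ m → from (e _) , to (e _)

  Σ⁰-resp : {A B : SetN} → A ≈ B → Σ⁰ n X A → Σ⁰ n X B
  Σ⁰-resp e = form-Σ⁰ ∘ ΣForm-resp (λ ρ → e (ρ zero)) ∘ Σ⁰-form

  Π⁰-resp : {A B : SetN} → A ≈ B → Π⁰ n X A → Π⁰ n X B
  Π⁰-resp e = form-Π⁰ ∘ ΠForm-resp (λ ρ → e (ρ zero)) ∘ Π⁰-form

  Σ⊆Δ : {A : SetN} → Σ⁰ n X A → Δ⁰ (suc n) X A
  Σ⊆Δ (φ , p , d) = form-Σ⁰ (ΣForm-resp (defines d) (Σ↑ p)) , form-Π⁰ (ΠForm-resp (defines d) (Σ⊆Π↑ p))

  Π⊆Δ : {A : SetN} → Π⁰ n X A → Δ⁰ (suc n) X A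
  Π⊆Δ (φ , p , d) = form-Σ⁰ (ΣForm-resp (defines d) (Π⊆Σ↑ p)) , form-Π⁰ (ΠForm-resp (defines d) (Π↑ p))

∁ : SetN → SetN
∁ A m = not (A m)

∈∁ : {A : SetN} (m : ℕ) → m ∈ ∁ A ⇔ (¬ m ∈ A)
∈∁ {A} m with A m
... | true = mk⇔ (λ ()) (λ ¬t → ⊥-elim (¬t refl))
... | false = mk⇔ (λ _ ()) (λ _ → refl)

∁∁ : {A : SetN} → ∁ (∁ A) ≈ A
∁∁ {A} = ≗⇒≈ λ m → not-involutive (A m)

⊕-even : ∀ C D j → (C ⊕ D) (j + j) ≡ C j
⊕-even C D zero = refl
⊕-even C D (suc j) rewrite +-suc j j = ⊕-even (C ∘ suc) (D ∘ suc) j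

⊕-odd : ∀ C D j → (C ⊕ D) (suc (j + j)) ≡ D j
⊕-odd C D zero = refl
⊕-odd C D (suc j) rewrite +-suc j j = ⊕-odd (C ∘ suc) (D ∘ suc) j

⊕-∁ : ∀ C D m → (∁ C ⊕ ∁ D) m ≡ ∁ (C ⊕ D) m
⊕-∁ C D zero = refl
⊕-∁ C D (suc zero) = refl
⊕-∁ C D (suc (suc m)) = ⊕-∁ (C ∘ suc) (D ∘ suc) m

parity : ∀ m → Σ ℕ λ j → m ≡ j + j ⊎ m ≡ suc (j + j)
parity zero = zero , inj₁ refl
parity (suc m) with parity m
... | j , inj₁ e = j , inj₂ (cong suc e)
... | j , inj₂ e = suc j , inj₁ (cong suc (trans e (sym (+-suc j j))))

JoinCases : SetN → SetN → ℕ → Set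
JoinCases C D m = Σ ℕ λ j → (m ≡ j + j × j ∈ C) ⊎ (m ≡ suc (j + j) × j ∈ D)

⊕-spec : {C D : SetN} (m : ℕ) → m ∈ (C ⊕ D) ⇔ JoinCases C D m
⊕-spec {C} {D} m = mk⇔ (split (parity m)) join
  where
    split : (Σ ℕ λ j → m ≡ j + j ⊎ m ≡ suc (j + j)) → m ∈ (C ⊕ D) → JoinCases C D m
    split (j , inj₁ refl) h = j , inj₁ (refl , trans (sym (⊕-even C D j)) h)
    split (j , inj₂ refl) h = j , inj₂ (refl , trans (sym (⊕-odd C D j)) h)

    join : JoinCases C D m → m ∈ (C ⊕ D)
    join (j , inj₁ (refl , c)) = trans (⊕-even C D j) c
    join (j , inj₂ (refl , d)) = trans (⊕-odd C D j) d

module _ (em : ExcludedMiddle 0ℓ) {X : SetN} where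
  open Forms (one X)
  open ClassicalForms em (one X)

  Σ⁰→Π⁰∁ : {A : SetN} → Σ⁰ n X A → Π⁰ n X (∁ A)
  Σ⁰→Π⁰∁ {A = A} (φ , p , d) =
    form-Π⁰ (ΠForm-resp (λ ρ → ⇔-sym (∈∁ {A} (ρ zero)) ⇔-∘ ¬-cong-⇔ (defines d ρ)) (¬Σ p))

  Π⁰→Σ⁰∁ : {A : SetN} → Π⁰ n X A → Σ⁰ n X (∁ A)
  Π⁰→Σ⁰∁ {A = A} (φ , p , d) =
    form-Σ⁰ (ΣForm-resp (λ ρ → ⇔-sym (∈∁ {A} (ρ zero)) ⇔-∘ ¬-cong-⇔ (defines d ρ)) (¬Π p))

  Σ⁰⇔Π⁰∁ : {A : SetN} → Σ⁰ n X A ⇔ Π⁰ n X (∁ A)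
  Σ⁰⇔Π⁰∁ = mk⇔ Σ⁰→Π⁰∁ (Σ⁰-resp ∁∁ ∘ Π⁰→Σ⁰∁)

  Π⁰⇔Σ⁰∁ : {A : SetN} → Π⁰ n X A ⇔ Σ⁰ n X (∁ A)
  Π⁰⇔Σ⁰∁ = mk⇔ Π⁰→Σ⁰∁ (Π⁰-resp ∁∁ ∘ Σ⁰→Π⁰∁)

  Δ⁰-∁ : {A : SetN} → Δ⁰ n X A → Δ⁰ n X (∁ A)
  Δ⁰-∁ (σA , πA) = Π⁰→Σ⁰∁ πA , Σ⁰→Π⁰∁ σA

  ProperΣ⇔ProperΠ∁ : {A : SetN} → ProperΣ n X A ⇔ ProperΠ n X (∁ A)
  ProperΣ⇔ProperΠ∁ = Σ⁰⇔Π⁰∁ ×-⇔ ¬-cong-⇔ Π⁰⇔Σ⁰∁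

  ProperΠ⇔ProperΣ∁ : {A : SetN} → ProperΠ n X A ⇔ ProperΣ n X (∁ A)
  ProperΠ⇔ProperΣ∁ = Π⁰⇔Σ⁰∁ ×-⇔ ¬-cong-⇔ Σ⁰⇔Π⁰∁

  -- For positive levels the join of Σ (Π, Δ) sets is Σ (Π, Δ):
  -- m ∈ C ⊕ D ↔ ∃ j ((m = j + j ∧ j ∈ C) ∨ (m = 2j + 1 ∧ j ∈ D)).
  joinΣ : {C D : SetN} → Σ⁰ (suc n) X C → Σ⁰ (suc n) X D → Σ⁰ (suc n) X (C ⊕ D)
  joinΣ σC σD = form-Σ⁰ (ΣForm-resp (λ ρ → ⇔-sym (⊕-spec (ρ zero)))
    (∃Σ (∪Σ (tagged (var zero ⊞ var zero) σC) (tagged (sc (var zero ⊞ var zero)) σD))))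
    where
      -- "m = t(j) and j ∈ A", with j the innermost variable and m the outer one.
      tagged : {A : SetN} (t : Term 2) → Σ⁰ (suc n) X A →
        ΣForm (suc n) (λ ρ → ρ (suc zero) ≡ evalT ρ t × ρ zero ∈ A)
      tagged t σA = ∩Σ {θ = var (suc zero) ≐ t} _ (substΣ (λ _ → var zero) (Σ⁰-form σA))

  joinΠ : {C D : SetN} → Π⁰ (suc n) X C → Π⁰ (suc n) X D → Π⁰ (suc n) X (C ⊕ D)
  joinΠ {C = C} {D} πC πD =
    from Π⁰⇔Σ⁰∁ (Σ⁰-resp (≗⇒≈ (⊕-∁ C D)) (joinΣ (to Π⁰⇔Σ⁰∁ πC) (to Π⁰⇔Σ⁰∁ πD)))

  joinΔ : {C D : SetN} → Δ⁰ (suc n) X C → Δ⁰ (suc n) X D → Δ⁰ (suc n) X (C ⊕ D)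
  joinΔ (σC , πC) (σD , πD) = joinΣ σC σD , joinΠ πC πD

  -- The halves of a join are preimages under m ↦ 2m and m ↦ 2m + 1.
  evenΣ : {C D : SetN} → Σ⁰ n X (C ⊕ D) → Σ⁰ n X C
  evenΣ {C = C} {D} σ = form-Σ⁰ (ΣForm-resp (λ ρ → ≗⇒≈ (⊕-even C D) (ρ zero))
    (substΣ (λ _ → var zero ⊞ var zero) (Σ⁰-form σ)))

  oddΠ : {C D : SetN} → Π⁰ n X (C ⊕ D) → Π⁰ n X D
  oddΠ {C = C} {D} π = form-Π⁰ (ΠForm-resp (λ ρ → ≗⇒≈ (⊕-odd C D) (ρ zero))
    (substΠ (λ _ → sc (var zero ⊞ var zero)) (Π⁰-form π)))

-- Relativisation: membership in X becomes membership of the double in X ⊕ Y.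
relF : Formula 1 v → Formula 1 v
relF (s ≐ t) = s ≐ t
relF (s ≺ t) = s ≺ t
relF (mem zero t) = mem zero (t ⊞ t)
relF (¬' φ) = ¬' relF φ
relF (φ ∧' ψ) = relF φ ∧' relF ψ
relF (φ ∨' ψ) = relF φ ∨' relF ψ
relF (φ ⇒' ψ) = relF φ ⇒' relF ψ
relF (∀< t φ) = ∀< t (relF φ)
relF (∃< t φ) = ∃< t (relF φ)
relF (∀' φ) = ∀' (relF φ)
relF (∃' φ) = ∃' (relF φ)

Sat-rel : (X Y : SetN) {ρ : Fin v → ℕ} (φ : Formula 1 v) →
  Sat (one (X ⊕ Y)) ρ (relF φ) ⇔ Sat (one X) ρ φ
Sat-rel X Y (s ≐ t) = ⇔-id _
Sat-rel X Y (s ≺ t) = ⇔-id _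
Sat-rel X Y {ρ} (mem zero t) = ≡⇒⇔ (cong (_≡ true) (⊕-even X Y (evalT ρ t)))
Sat-rel X Y (¬' φ) = ¬-cong-⇔ (Sat-rel X Y φ)
Sat-rel X Y (φ ∧' ψ) = Sat-rel X Y φ ×-⇔ Sat-rel X Y ψ
Sat-rel X Y (φ ∨' ψ) = Sat-rel X Y φ ⊎-⇔ Sat-rel X Y ψ
Sat-rel X Y (φ ⇒' ψ) = →-cong-⇔ (Sat-rel X Y φ) (Sat-rel X Y ψ)
Sat-rel X Y (∀< t φ) = ∀-⇔ λ m → →-cong-⇔ (⇔-id _) (Sat-rel X Y φ)
Sat-rel X Y (∃< t φ) = ∃-⇔ λ m → ⇔-id _ ×-⇔ Sat-rel X Y φ
Sat-rel X Y (∀' φ) = ∀-⇔ λ m → Sat-rel X Y φ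
Sat-rel X Y (∃' φ) = ∃-⇔ λ m → Sat-rel X Y φ

relΔ₀ : (φ : Formula 1 v) → IsΔ₀ φ → IsΔ₀ (relF φ)
relΔ₀ (s ≐ t) d = d
relΔ₀ (s ≺ t) d = d
relΔ₀ (mem zero t) d = d
relΔ₀ (¬' φ) d = relΔ₀ φ d
relΔ₀ (φ ∧' ψ) (a , b) = relΔ₀ φ a , relΔ₀ ψ b
relΔ₀ (φ ∨' ψ) (a , b) = relΔ₀ φ a , relΔ₀ ψ b
relΔ₀ (φ ⇒' ψ) (a , b) = relΔ₀ φ a , relΔ₀ ψ b
relΔ₀ (∀< t φ) d = relΔ₀ φ d
relΔ₀ (∃< t φ) d = relΔ₀ φ d

mutual
  relIsΣ : {φ : Formula 1 v} → IsΣ n φ → IsΣ n (relF φ)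
  relIsΣ (σ₀ {φ = φ} d) = σ₀ (relΔ₀ φ d)
  relIsΣ (σ∃ p) = σ∃ (relIsΣ p)
  relIsΣ (σΠ p) = σΠ (relIsΠ p)

  relIsΠ : {φ : Formula 1 v} → IsΠ n φ → IsΠ n (relF φ)
  relIsΠ (π₀ {φ = φ} d) = π₀ (relΔ₀ φ d)
  relIsΠ (π∀ p) = π∀ (relIsΠ p)
  relIsΠ (πΣ p) = πΣ (relIsΣ p)

relDefinedBy : {X Y A : SetN} {φ : Formula 1 1} → DefinedBy X φ A → DefinedBy (X ⊕ Y) (relF φ) A
relDefinedBy {X} {Y} {φ = φ} d m = from (Sat-rel X Y φ) ∘ proj₁ (d m) , proj₂ (d m) ∘ to (Sat-rel X Y φ)

relΣ⁰ : {X Y A : SetN} → Σ⁰ n X A → Σ⁰ n (X ⊕ Y) A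
relΣ⁰ (φ , p , d) = relF φ , relIsΣ p , relDefinedBy d

relΠ⁰ : {X Y A : SetN} → Π⁰ n X A → Π⁰ n (X ⊕ Y) A
relΠ⁰ (φ , p , d) = relF φ , relIsΠ p , relDefinedBy d

relΔ⁰ : {X Y A : SetN} → Δ⁰ n X A → Δ⁰ n (X ⊕ Y) A
relΔ⁰ (σA , πA) = relΣ⁰ σA , relΠ⁰ πA

-- An injective pairing function (pair a b = 2ᵃ(2b + 1) − 1).
pair : ℕ → ℕ → ℕ
pair zero b = 2 * b
pair (suc a) b = suc (2 * pair a b)

pair-injective : ∀ {a b c d} → pair a b ≡ pair c d → a ≡ c × b ≡ d
pair-injective {zero} {b} {zero} {d} e = refl , *-cancelˡ-≡ b d 2 e
pair-injective {zero} {b} {suc c} {d} e = ⊥-elim (even≢odd b (pair c d) e)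
pair-injective {suc a} {b} {zero} {d} e = ⊥-elim (even≢odd d (pair a b) (sym e))
pair-injective {suc a} {b} {suc c} {d} e
  with pair-injective {a} {b} {c} {d} (*-cancelˡ-≡ (pair a b) (pair c d) 2 (suc-injective e))
... | refl , refl = refl , refl

data Tree : Set where
  node : ℕ → List Tree → Tree

leaf : ℕ → Tree
leaf a = node a []

mutual
  codeTree : Tree → ℕ
  codeTree (node a ts) = pair a (codeForest ts)

  codeForest : List Tree → ℕ
  codeForest [] = 0
  codeForest (t ∷ ts) = suc (pair (codeTree t) (codeForest ts))

mutual
  codeTree-injective : ∀ t u → codeTree t ≡ codeTree u → t ≡ u
  codeTree-injective (node a ts) (node b us) e with pair-injective {a} {_} {b} e
  ... | refl , e′ = cong (node a) (codeForest-injective ts us e′)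

  codeForest-injective : ∀ ts us → codeForest ts ≡ codeForest us → ts ≡ us
  codeForest-injective [] [] _ = refl
  codeForest-injective (t ∷ ts) (u ∷ us) e with pair-injective {codeTree t} {_} {codeTree u} (suc-injective e)
  ... | e₁ , e₂ = cong₂ _∷_ (codeTree-injective t u e₁) (codeForest-injective ts us e₂)

-- Terms and formulas as trees; the decodings are left inverses, so the
-- encodings are injective.
finAt : ℕ → Maybe (Fin v)
finAt {zero} _ = nothing
finAt {suc v} zero = just zero
finAt {suc v} (suc i) = Maybe.map suc (finAt i)

finAt-toℕ : (i : Fin v) → finAt (toℕ i) ≡ just i
finAt-toℕ zero = refl
finAt-toℕ (suc i) = cong (Maybe.map suc) (finAt-toℕ i)

termTree : Term v → Tree
termTree (var i) = node 0 (leaf (toℕ i) ∷ [])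
termTree zer = node 1 []
termTree (sc t) = node 2 (termTree t ∷ [])
termTree (s ⊞ t) = node 3 (termTree s ∷ termTree t ∷ [])
termTree (s ⊠ t) = node 4 (termTree s ∷ termTree t ∷ [])

treeTerm : Tree → Term v
treeTerm (node 0 (node i [] ∷ [])) = maybe′ var zer (finAt i)
treeTerm (node 2 (t ∷ [])) = sc (treeTerm t)
treeTerm (node 3 (s ∷ t ∷ [])) = treeTerm s ⊞ treeTerm t
treeTerm (node 4 (s ∷ t ∷ [])) = treeTerm s ⊠ treeTerm t
treeTerm _ = zer

treeTerm-termTree : (t : Term v) → treeTerm (termTree t) ≡ t
treeTerm-termTree (var i) = cong (maybe′ var zer) (finAt-toℕ i)
treeTerm-termTree zer = refl
treeTerm-termTree (sc t) = cong sc (treeTerm-termTree t)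
treeTerm-termTree (s ⊞ t) = cong₂ _⊞_ (treeTerm-termTree s) (treeTerm-termTree t)
treeTerm-termTree (s ⊠ t) = cong₂ _⊠_ (treeTerm-termTree s) (treeTerm-termTree t)

formulaTree : Formula k v → Tree
formulaTree (s ≐ t) = node 0 (termTree s ∷ termTree t ∷ [])
formulaTree (s ≺ t) = node 1 (termTree s ∷ termTree t ∷ [])
formulaTree (mem i t) = node 2 (leaf (toℕ i) ∷ termTree t ∷ [])
formulaTree (¬' φ) = node 3 (formulaTree φ ∷ [])
formulaTree (φ ∧' ψ) = node 4 (formulaTree φ ∷ formulaTree ψ ∷ [])
formulaTree (φ ∨' ψ) = node 5 (formulaTree φ ∷ formulaTree ψ ∷ [])
formulaTree (φ ⇒' ψ) = node 6 (formulaTree φ ∷ formulaTree ψ ∷ [])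
formulaTree (∀< t φ) = node 7 (termTree t ∷ formulaTree φ ∷ [])
formulaTree (∃< t φ) = node 8 (termTree t ∷ formulaTree φ ∷ [])
formulaTree (∀' φ) = node 9 (formulaTree φ ∷ [])
formulaTree (∃' φ) = node 10 (formulaTree φ ∷ [])

treeFormula : Tree → Formula k v
treeFormula (node 0 (s ∷ t ∷ [])) = treeTerm s ≐ treeTerm t
treeFormula (node 1 (s ∷ t ∷ [])) = treeTerm s ≺ treeTerm t
treeFormula (node 2 (node i [] ∷ t ∷ [])) = maybe′ (λ j → mem j (treeTerm t)) (zer ≐ zer) (finAt i)
treeFormula (node 3 (φ ∷ [])) = ¬' treeFormula φ
treeFormula (node 4 (φ ∷ ψ ∷ [])) = treeFormula φ ∧' treeFormula ψ
treeFormula (node 5 (φ ∷ ψ ∷ [])) = treeFormula φ ∨' treeFormula ψ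
treeFormula (node 6 (φ ∷ ψ ∷ [])) = treeFormula φ ⇒' treeFormula ψ
treeFormula (node 7 (t ∷ φ ∷ [])) = ∀< (treeTerm t) (treeFormula φ)
treeFormula (node 8 (t ∷ φ ∷ [])) = ∃< (treeTerm t) (treeFormula φ)
treeFormula (node 9 (φ ∷ [])) = ∀' (treeFormula φ)
treeFormula (node 10 (φ ∷ [])) = ∃' (treeFormula φ)
treeFormula _ = zer ≐ zer

treeFormula-formulaTree : (φ : Formula k v) → treeFormula (formulaTree φ) ≡ φ
treeFormula-formulaTree (s ≐ t) = cong₂ _≐_ (treeTerm-termTree s) (treeTerm-termTree t)
treeFormula-formulaTree (s ≺ t) = cong₂ _≺_ (treeTerm-termTree s) (treeTerm-termTree t)
treeFormula-formulaTree (mem i t) =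
  cong₂ (λ j s → maybe′ (λ j′ → mem j′ s) (zer ≐ zer) j) (finAt-toℕ i) (treeTerm-termTree t)
treeFormula-formulaTree (¬' φ) = cong ¬'_ (treeFormula-formulaTree φ)
treeFormula-formulaTree (φ ∧' ψ) = cong₂ _∧'_ (treeFormula-formulaTree φ) (treeFormula-formulaTree ψ)
treeFormula-formulaTree (φ ∨' ψ) = cong₂ _∨'_ (treeFormula-formulaTree φ) (treeFormula-formulaTree ψ)
treeFormula-formulaTree (φ ⇒' ψ) = cong₂ _⇒'_ (treeFormula-formulaTree φ) (treeFormula-formulaTree ψ)
treeFormula-formulaTree (∀< t φ) = cong₂ ∀< (treeTerm-termTree t) (treeFormula-formulaTree φ)
treeFormula-formulaTree (∃< t φ) = cong₂ ∃< (treeTerm-termTree t) (treeFormula-formulaTree φ)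
treeFormula-formulaTree (∀' φ) = cong ∀' (treeFormula-formulaTree φ)
treeFormula-formulaTree (∃' φ) = cong ∃' (treeFormula-formulaTree φ)

code : Formula k v → ℕ
code = codeTree ∘ formulaTree

code-injective : {φ ψ : Formula k v} → code φ ≡ code ψ → φ ≡ ψ
code-injective {φ = φ} {ψ} e = begin
  φ                             ≡⟨ sym (treeFormula-formulaTree φ) ⟩
  treeFormula (formulaTree φ)   ≡⟨ cong treeFormula (codeTree-injective (formulaTree φ) (formulaTree ψ) e) ⟩
  treeFormula (formulaTree ψ)   ≡⟨ treeFormula-formulaTree ψ ⟩
  ψ                             ∎
  where open ≡-Reasoning

Δ∖Σ-preserved : ℕ → SetN → SetN → Set
Δ∖Σ-preserved n X Y =
  ∀ A → Δ⁰ (suc n) X A → ¬ Σ⁰ n X A → Δ⁰ (suc n) (X ⊕ Y) A × ¬ Σ⁰ n (X ⊕ Y) A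

AvoidsSequences : ℕ → Formula 2 0 → Set
AvoidsSequences n φ =
  ∀ Z X → X ≤T Z → (As : ℕ → SetN) → (∀ i → ¬ Σ⁰ n Z (As i)) →
    Σ SetN λ Y → Holds φ X Y × (∀ i → ¬ Σ⁰ n (Z ⊕ Y) (As i))

module _ (em : ExcludedMiddle 0ℓ) where

  -- Part (1): A is properly Πₙ iff ∁A is properly Σₙ, relative to any oracle.
  PresΣ⇒PresΠ : {X Y : SetN} → PresΣ n X Y → PresΠ n X Y
  PresΣ⇒PresΠ P A properΠ = from (ProperΠ⇔ProperΣ∁ em) (P (∁ A) (to (ProperΠ⇔ProperΣ∁ em) properΠ))

  PresΠ⇒PresΣ : {X Y : SetN} → PresΠ n X Y → PresΣ n X Y
  PresΠ⇒PresΣ P A properΣ = from (ProperΣ⇔ProperΠ∁ em) (P (∁ A) (to (ProperΣ⇔ProperΠ∁ em) properΣ))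

  -- Part (2): if A is properly Πₙ₊₁ relative to X, then A ⊕ ∁A is properly
  -- Δₙ₊₂ relative to X, and it would become Σₙ₊₁ relative to X ⊕ Y if A did.
  PresΔ⇒PresΠ : {X Y : SetN} → PresΔ (suc n) X Y → PresΠ (suc n) X Y
  PresΔ⇒PresΠ {n} {X} {Y} P A (πA , ¬σA) = relΠ⁰ πA , ¬σA′
    where
      B : SetN
      B = A ⊕ ∁ A

      B-properΔ : ProperΔ (suc n) X B
      B-properΔ = joinΔ em (Π⊆Δ πA) (Σ⊆Δ (to (Π⁰⇔Σ⁰∁ em) πA))
                , ¬σA ∘ evenΣ em
                , ¬σA ∘ from (Σ⁰⇔Π⁰∁ em) ∘ oddΠ em

      ¬σA′ : ¬ Σ⁰ (suc n) (X ⊕ Y) A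
      ¬σA′ σA = proj₁ (proj₂ (P B B-properΔ)) (joinΣ em σA (to (Π⁰⇔Σ⁰∁ em) (relΠ⁰ πA)))

  -- Part (3), right to left: apply the hypothesis to A and to ∁A.
  Δ∖Σ⇒PresΔ : {X Y : SetN} → Δ∖Σ-preserved n X Y → PresΔ n X Y
  Δ∖Σ⇒PresΔ {n} {X} {Y} r A (δA , ¬σA , ¬πA) = proj₁ (r A δA ¬σA) , proj₂ (r A δA ¬σA) , ¬πA′
    where
      ¬πA′ : ¬ Π⁰ n (X ⊕ Y) A
      ¬πA′ = proj₂ (r (∁ A) (Δ⁰-∁ em δA) (¬πA ∘ from (Π⁰⇔Σ⁰∁ em))) ∘ to (Π⁰⇔Σ⁰∁ em)

  -- Part (3), left to right: a set in Δₙ₊₁ − Σₙ is either properly Πₙ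
  -- (handled by part (2)) or properly Δₙ₊₁.
  PresΔ⇒Δ∖Σ : {X Y : SetN} → PresΔ (suc n) X Y → Δ∖Σ-preserved (suc n) X Y
  PresΔ⇒Δ∖Σ {n} {X} P A δA ¬σA with em {Π⁰ (suc n) X A}
  ... | yes πA = relΔ⁰ δA , proj₂ (PresΔ⇒PresΠ P A (πA , ¬σA))
  ... | no ¬πA = proj₁ (P A (δA , ¬σA , ¬πA)) , proj₁ (proj₂ (P A (δA , ¬σA , ¬πA)))

  setOf : (ℕ → Set) → SetN
  setOf P m = does (em {P m})

  ∈setOf : {P : ℕ → Set} (m : ℕ) → m ∈ setOf P ⇔ P m
  ∈setOf {P} m with em {P m}
  ... | yes p = mk⇔ (λ _ → p) (λ _ → refl)
  ... | no ¬p = mk⇔ (λ ()) (⊥-elim ∘ ¬p)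

  -- A single sequence of non-Σᶻₙ sets containing, up to ≈, every set
  -- arithmetical in Z that is not Σᶻₙ: its i-th member is the set defined
  -- by the formula with code i when that set is not Σᶻₙ, and otherwise a
  -- diagonal set that no formula defines over Z.
  module UniversalSequence (n : ℕ) (Z : SetN) where

    _holds-of_ : Formula 1 1 → ℕ → Set
    φ holds-of m = Sat (one Z) (λ _ → m) φ

    ⟦_⟧ᶻ : Formula 1 1 → SetN
    ⟦ φ ⟧ᶻ = setOf (φ holds-of_)

    ⟦⟧ᶻ-defined : {φ : Formula 1 1} {A : SetN} → DefinedBy Z φ A → ⟦ φ ⟧ᶻ ≈ A
    ⟦⟧ᶻ-defined {φ} d m = defines d (λ _ → m) ⇔-∘ ∈setOf {φ holds-of_} m

    Diagonal : ℕ → Set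
    Diagonal m = ¬ Σ (Formula 1 1) λ φ → code φ ≡ m × φ holds-of m

    diagonal : SetN
    diagonal = setOf Diagonal

    diagonal-undefinable : ¬ Σ (Formula 1 1) λ ψ → DefinedBy Z ψ diagonal
    diagonal-undefinable (ψ , d) =
      ¬[S⇔¬S] ((¬-cong-⇔ coded ⇔-∘ ∈setOf {Diagonal} (code ψ)) ⇔-∘ defines d (λ _ → code ψ))
      where
        coded : (Σ (Formula 1 1) λ φ → code φ ≡ code ψ × φ holds-of code ψ) ⇔ ψ holds-of code ψ
        coded = mk⇔ (λ (φ , e , s) → subst (_holds-of code ψ) (code-injective e) s)
                    (λ s → ψ , refl , s)

    Candidate : ℕ → Set
    Candidate i = Σ (Formula 1 1) λ φ → code φ ≡ i × ¬ Σ⁰ n Z ⟦ φ ⟧ᶻ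

    choose : {i : ℕ} → Dec (Candidate i) → SetN
    choose (yes (φ , _)) = ⟦ φ ⟧ᶻ
    choose (no _) = diagonal

    universal : ℕ → SetN
    universal i = choose (em {Candidate i})

    universal-nonΣ : ∀ i → ¬ Σ⁰ n Z (universal i)
    universal-nonΣ i = chosen-nonΣ (em {Candidate i})
      where
        chosen-nonΣ : (c : Dec (Candidate i)) → ¬ Σ⁰ n Z (choose c)
        chosen-nonΣ (yes (_ , _ , ¬σ)) = ¬σ
        chosen-nonΣ (no _) (φ , _ , d) = diagonal-undefinable (φ , d)

    universal-complete : {ψ : Formula 1 1} {A : SetN} →
      DefinedBy Z ψ A → ¬ Σ⁰ n Z A → universal (code ψ) ≈ A
    universal-complete {ψ} {A} d ¬σA = chosen (em {Candidate (code ψ)})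
      where
        chosen : (c : Dec (Candidate (code ψ))) → choose c ≈ A
        chosen (yes (φ , e , _)) = subst (λ φ → ⟦ φ ⟧ᶻ ≈ A) (sym (code-injective e)) (⟦⟧ᶻ-defined d)
        chosen (no ¬c) = ⊥-elim (¬c (ψ , refl , ¬σA ∘ Σ⁰-resp (⟦⟧ᶻ-defined d)))

    -- If no member of the sequence becomes Σₙ relative to Z ⊕ Y, then no
    -- arithmetical non-Σᶻₙ set does, so Y preserves all three kinds.
    avoidance⇒preservation : {Y : SetN} → (∀ i → ¬ Σ⁰ n (Z ⊕ Y) (universal i)) →
      PresΣ n Z Y × PresΠ n Z Y × PresΔ n Z Y
    avoidance⇒preservation {Y} avoids = PresΠ⇒PresΣ presΠ , presΠ , Δ∖Σ⇒PresΔ preservedΔ∖Σ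
      where
        avoid : {ψ : Formula 1 1} {A : SetN} → DefinedBy Z ψ A → ¬ Σ⁰ n Z A → ¬ Σ⁰ n (Z ⊕ Y) A
        avoid d ¬σA σA = avoids _ (Σ⁰-resp (≈-sym (universal-complete d ¬σA)) σA)

        presΠ : PresΠ n Z Y
        presΠ A (πA@(_ , _ , d) , ¬σA) = relΠ⁰ πA , avoid d ¬σA

        preservedΔ∖Σ : Δ∖Σ-preserved n Z Y
        preservedΔ∖Σ A δA@((_ , _ , d) , _) ¬σA = relΔ⁰ δA , avoid d ¬σA

  simultaneous-preservation : (φ : Formula 2 0) → AvoidsSequences n φ → AdmitsSimulPres n φ
  simultaneous-preservation {n} φ H Z X X≤Z =
    let open UniversalSequence n Z
        (Y , holds , avoids) = H Z X X≤Z universal universal-nonΣ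
    in Y , holds , avoidance⇒preservation avoids

proposition2p2 : ExcludedMiddle 0ℓ → (n : ℕ) → 0 < n → (X Y : SetN) →
      (PresΣ n X Y ⇔ PresΠ n X Y)
    × (PresΔ n X Y → PresΠ n X Y)
    × (PresΔ n X Y ⇔ (∀ A → Δ⁰ (suc n) X A → ¬ Σ⁰ n X A →
                        Δ⁰ (suc n) (X ⊕ Y) A × ¬ Σ⁰ n (X ⊕ Y) A))
    × ((φ : Formula 2 0) →
         (∀ Z X' → X' ≤T Z → (As : ℕ → SetN) → (∀ i → ¬ Σ⁰ n Z (As i)) →
            Σ SetN λ Y' → Holds φ X' Y' × (∀ i → ¬ Σ⁰ n (Z ⊕ Y') (As i)))
         → AdmitsSimulPres n φ)
proposition2p2 em zero () X Y
proposition2p2 em (suc n) _ X Y =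
    mk⇔ (PresΣ⇒PresΠ em) (PresΠ⇒PresΣ em)
  , PresΔ⇒PresΠ em
  , mk⇔ (PresΔ⇒Δ∖Σ em) (Δ∖Σ⇒PresΔ em)
  , simultaneous-preservation em
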